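{- Let $n$ be a positive integer and let $h$ be the smallest positive integer such that $$h^2\equiv 0 \pmod{n}\quad\text{and}\quad (\nu_2(n),\nu_2(h))\neq(1,1).$$ Define $$k=\begin{cases} n/h & \text{if } \nu_2(n)\neq 1,\\ 2n/h & \text{otherwise.}\end{cases}$$ Then there exist $k$ group ring elements $D_0,\dots,D_{k-1}\in \mathbb{Z}[\zeta_h][\mathbb{Z}_{n/k}]$ with the following properties: (a) for each $i$, $D_i=\sum_{g\in\mathbb{Z}_{n/k}} a_{ig}\,g$ where every coefficient $a_{ig}$ is a complex $h$th root of unity; (b) $D_iD_j^{(-1)}=0$ for all $0\le i\neq j\le k-1$, and $\sum_{i=0}^{k-1}D_iD_i^{(-1)}=n$.
   Context: $\nu_2(x)$ denotes the $2$-adic valuation of the integer $x$. $\zeta_h$ is a primitive complex $h$th root of unity, $\mathbb{Z}_t$ denotes the cyclic group of order $t$, and for a finite group $G$ and ring $R$, $R[G]$ is the group ring. For $X=\sum_{g\in G}a_g g\in \mathbb{Z}[\zeta_h][G]$, $X^{(-1)}=\sum_{g\in G}\overline{a_g}\,g^{ -1}$ (complex conjugation of coefficients). An integer $\lambda$ is identified with the group ring element $\lambda\cdot 1_G$. -}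

module Defs where

open import Data.Nat as ℕ using (ℕ; zero; suc; _^_)
open import Data.Nat.Divisibility using (_∣_; _∣?_)
open import Data.Nat.Primality using (Prime; prime?)
open import Data.Nat.DivMod using (_mod_; _/_)
open import Data.Fin as Fin using (Fin; toℕ)
open import Data.Integer as ℤ using (ℤ; +_)
open import Data.List using (List; foldr; filter; upTo)
open import Data.Product using (_×_)
open import Relation.Nullary using (¬_; yes; no)
open import Relation.Nullary.Decidable using (_×-dec_)
open import Relation.Binary.PropositionalEquality using (_≡_)

-- 2-adic valuation, relationally:  Val2 n v  means  ν₂(n) = v  (for n > 0).
Val2 : ℕ → ℕ → Set
Val2 n v = (2 ^ v ∣ n) × ¬ (2 ^ suc v ∣ n)

infixl 6 _⊕_ _⊝_
_⊕_ : ∀ {m} → Fin m → Fin m → Fin m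
_⊕_ {suc m} a b = (toℕ a ℕ.+ toℕ b) mod suc m

⊖_ : ∀ {m} → Fin m → Fin m
⊖_ {suc m} a = (suc m ℕ.∸ toℕ a) mod suc m

_⊝_ : ∀ {m} → Fin m → Fin m → Fin m
a ⊝ b = a ⊕ (⊖ b)

∑ : ∀ {m} → (Fin m → ℤ) → ℤ
∑ {zero} f = + 0
∑ {suc m} f = f Fin.zero ℤ.+ ∑ (λ x → f (Fin.suc x))

-- Z[ζ_h], realised as Z[C_h] = Z[x]/(x^h - 1) (a representative,
-- the coefficient of x^t being  a t) modulo the kernel of  x ↦ ζ_h.

Cyc : ℕ → Set
Cyc h = Fin h → ℤ

module _ {h : ℕ} where

  δ : Fin h → Cyc h            -- ζ_h ^ e
  δ e t with e Fin.≟ t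
  ... | yes _ = + 1
  ... | no  _ = + 0

  0C : Cyc h
  0C t = + 0

  _+C_ : Cyc h → Cyc h → Cyc h
  (a +C b) t = a t ℤ.+ b t

  _-C_ : Cyc h → Cyc h → Cyc h
  (a -C b) t = a t ℤ.- b t

  _*C_ : Cyc h → Cyc h → Cyc h
  (a *C b) t = ∑ (λ s → a s ℤ.* b (t ⊝ s))

  -- complex conjugation: ζ ↦ ζ⁻¹
  conjC : Cyc h → Cyc h
  conjC a t = a (⊖ t)

oneC : ∀ {h} → Cyc h
oneC {zero} ()
oneC {suc h} = δ Fin.zero

ιC : ∀ {h} → ℤ → Cyc h
ιC λ' t = λ' ℤ.* oneC t

δℕ : ∀ {h} → ℕ → Cyc h
δℕ {zero} e ()
δℕ {suc h} e = δ (e mod suc h)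

-- Ψ_h = ∏_{p prime, p ∣ h} (x^{h/p} - 1).  Since x^h - 1 is squarefree
-- over Q, Φ_h ∣ P  iff  (x^h - 1) ∣ P · Ψ_h, i.e. the kernel of
-- Z[C_h] → Z[ζ_h] is { a | a · Ψ_h = 0 in Z[C_h] }.
Ψ : (h : ℕ) → Cyc h
Ψ h = foldr (λ q acc → acc *C (δℕ (h / suc q) -C oneC)) oneC
            (filter (λ q → prime? (suc q) ×-dec (suc q ∣? h)) (upTo h))

_≈C_ : ∀ {h} → Cyc h → Cyc h → Set
_≈C_ {h} a b = ∀ t → ((a -C b) *C Ψ h) t ≡ + 0

GR : ℕ → ℕ → Set
GR m h = Fin m → Cyc h

module _ {m h : ℕ} where

  _*G_ : GR m h → GR m h → GR m h
  (X *G Y) g t = ∑ (λ x → (X x *C Y (g ⊝ x)) t)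

  _⁻¹G : GR m h → GR m h
  (X ⁻¹G) g = conjC (X (⊖ g))

  0G : GR m h
  0G g = 0C

  _≈G_ : GR m h → GR m h → Set
  X ≈G Y = ∀ g → X g ≈C Y g

ιG : ∀ {m h} → ℤ → GR m h
ιG {zero} λ' ()
ιG {suc m} λ' g with g Fin.≟ Fin.zero
... | yes _ = ιC λ'
... | no  _ = 0C

∑G : ∀ {k m h} → (Fin k → GR m h) → GR m h
∑G F g t = ∑ (λ i → F i g t)

{-# OPTIONS --safe #-}
-- Write h = R m, m = L k and D_i = Σ_{x ∈ Z_m} ζ_h^(E_i x) x with E_i x = R i x + β x², where
-- 2β ≡ R k (mod h) and h divides 2βL, 2βm and βm²; a parity analysis of n, h and k, using the
-- minimality of h, produces R, L and β. The coefficient of g in D_i D_j^(-1) is the power sum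
-- Σ_x ζ_h^(E_i x − E_j (x − g)). Replacing x by x + L multiplies it by ζ_h^(R L (i − j)), which is
-- not 1 when i ≠ j. For g ≠ 0, replacing x by x + 1 multiplies the diagonal sums by ζ_h^(R k g), and
-- when that is 1, replacing i by i + 1 multiplies Σ_i D_i D_i^(-1) at g by ζ_h^(R g) ≠ 1. Finally an
-- element of Z[ζ_h] fixed by multiplication with some ζ_h^a ≠ 1 is 0: the subgroup ⟨a⟩ of Z_h
-- contains a subgroup of prime order p, whose coset sums annihilate Ψ_h (a multiple of x^(h/p) − 1),
-- so p times the element vanishes.
module Submission where

open import Defs
open import Data.Nat.Base as ℕ using (ℕ; zero; suc; _<_; _≤_)
import Data.Nat.Properties as ℕ
open import Data.Nat.Divisibility using (_∣_; _∣?_; divides; quotient; m∣n⇒n≡quotient*m)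
open import Data.Fin.Base as Fin using (Fin; zero; suc; toℕ)
import Data.Fin.Properties as Fin
open import Data.Integer.Base as ℤ using (ℤ; +_)
import Data.Integer.Properties as ℤ
open import Data.Product using (Σ; _×_; _,_; proj₁; proj₂)
open import Data.Sum using (_⊎_; inj₁; inj₂)
open import Data.Empty using (⊥-elim)
open import Function using (_∘_)
open import Relation.Nullary using (¬_; Dec; yes; no)
open import Relation.Nullary.Decidable using (_×-dec_; ¬?)
open import Relation.Binary.PropositionalEquality
  using (_≡_; _≢_; refl; sym; trans; cong; cong₂; subst; module ≡-Reasoning)

module FiniteSums where

  open import Data.Integer.Base using (_+_; _*_; _-_)
  open import Data.Integer.Tactic.RingSolver using (solve-∀)
  open import Data.Fin.Permutation using (permutation)
  import Algebra.Properties.CommutativeMonoid.Sum ℤ.+-0-commutativeMonoid as Sum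

  ∑≡sum : ∀ {n} (f : Fin n → ℤ) → ∑ f ≡ Sum.sum f
  ∑≡sum {zero} f = refl
  ∑≡sum {suc n} f = cong (_+_ (f zero)) (∑≡sum (f ∘ suc))

  ∑-cong : ∀ {n} {f g : Fin n → ℤ} → (∀ x → f x ≡ g x) → ∑ f ≡ ∑ g
  ∑-cong {zero} f≗g = refl
  ∑-cong {suc n} f≗g = cong₂ _+_ (f≗g zero) (∑-cong (f≗g ∘ suc))

  ∑-zero : ∀ {n} {f : Fin n → ℤ} → (∀ x → f x ≡ + 0) → ∑ f ≡ + 0
  ∑-zero {zero} f≗0 = refl
  ∑-zero {suc n} f≗0 = cong₂ _+_ (f≗0 zero) (∑-zero (f≗0 ∘ suc))

  ∑-const : ∀ n (c : ℤ) → ∑ {n} (λ _ → c) ≡ + n * c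
  ∑-const zero c = refl
  ∑-const (suc n) c = trans (cong (_+_ c) (∑-const n c)) (lemma c (+ n))
    where lemma : ∀ c n → c + n * c ≡ (+ 1 + n) * c
          lemma = solve-∀

  ∑-distrib-- : ∀ {n} (f g : Fin n → ℤ) → ∑ (λ x → f x - g x) ≡ ∑ f - ∑ g
  ∑-distrib-- {zero} f g = refl
  ∑-distrib-- {suc n} f g =
    trans (cong (_+_ (f zero - g zero)) (∑-distrib-- (f ∘ suc) (g ∘ suc)))
          (lemma (f zero) (g zero) (∑ (f ∘ suc)) (∑ (g ∘ suc)))
    where lemma : ∀ a b c d → a - b + (c - d) ≡ a + c - (b + d)
          lemma = solve-∀

  *-distribˡ-∑ : ∀ {n} (c : ℤ) (f : Fin n → ℤ) → ∑ (λ x → c * f x) ≡ c * ∑ f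
  *-distribˡ-∑ {zero} c f = sym (ℤ.*-zeroʳ c)
  *-distribˡ-∑ {suc n} c f =
    trans (cong (_+_ (c * f zero)) (*-distribˡ-∑ c (f ∘ suc))) (sym (ℤ.*-distribˡ-+ c (f zero) _))

  *-distribʳ-∑ : ∀ {n} (c : ℤ) (f : Fin n → ℤ) → ∑ (λ x → f x * c) ≡ ∑ f * c
  *-distribʳ-∑ c f = trans (∑-cong (λ x → ℤ.*-comm (f x) c)) (trans (*-distribˡ-∑ c f) (ℤ.*-comm c (∑ f)))

  ∑-comm : ∀ {m n} (f : Fin m → Fin n → ℤ) → ∑ (λ i → ∑ (λ j → f i j)) ≡ ∑ (λ j → ∑ (λ i → f i j))
  ∑-comm f = begin
    ∑ (λ i → ∑ (f i))                     ≡⟨ ∑-cong (λ i → ∑≡sum (f i)) ⟩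
    ∑ (λ i → Sum.sum (f i))               ≡⟨ ∑≡sum (λ i → Sum.sum (f i)) ⟩
    Sum.sum (λ i → Sum.sum (f i))         ≡⟨ Sum.∑-comm f ⟩
    Sum.sum (λ j → Sum.sum (λ i → f i j)) ≡⟨ sym (∑≡sum (λ j → Sum.sum (λ i → f i j))) ⟩
    ∑ (λ j → Sum.sum (λ i → f i j))       ≡⟨ sym (∑-cong (λ j → ∑≡sum (λ i → f i j))) ⟩
    ∑ (λ j → ∑ (λ i → f i j))             ∎
    where open ≡-Reasoning

  ∑-reindex : ∀ {n} (f : Fin n → ℤ) (σ τ : Fin n → Fin n) →
              (∀ y → σ (τ y) ≡ y) → (∀ x → τ (σ x) ≡ x) → ∑ (f ∘ σ) ≡ ∑ f
  ∑-reindex f σ τ στ τσ = begin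
    ∑ (f ∘ σ)       ≡⟨ ∑≡sum (f ∘ σ) ⟩
    Sum.sum (f ∘ σ) ≡⟨ sym (Sum.∑-permute f (permutation σ τ στ τσ)) ⟩
    Sum.sum f       ≡⟨ sym (∑≡sum f) ⟩
    ∑ f             ∎
    where open ≡-Reasoning

  δ-diag : ∀ {h} (e : Fin h) → δ e e ≡ + 1
  δ-diag e with e Fin.≟ e
  ... | yes _ = refl
  ... | no e≢e = ⊥-elim (e≢e refl)

  δ-off : ∀ {h} {e t : Fin h} → e ≢ t → δ e t ≡ + 0
  δ-off {e = e} {t} e≢t with e Fin.≟ t
  ... | yes e≡t = ⊥-elim (e≢t e≡t)
  ... | no _ = refl

  δ-injective : ∀ {h h′} (f : Fin h → Fin h′) → (∀ {a b} → f a ≡ f b → a ≡ b) →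
                ∀ a b → δ (f a) (f b) ≡ δ a b
  δ-injective f f-inj a b with a Fin.≟ b | f a Fin.≟ f b
  ... | yes a≡b | yes _ = refl
  ... | yes a≡b | no fa≢fb = ⊥-elim (fa≢fb (cong f a≡b))
  ... | no a≢b | yes fa≡fb = ⊥-elim (a≢b (f-inj fa≡fb))
  ... | no _ | no _ = refl

  ∑-δ : ∀ {n} (a : Fin n) (f : Fin n → ℤ) → ∑ (λ s → δ a s * f s) ≡ f a
  ∑-δ {suc n} zero f =
    trans (cong₂ _+_ (trans (cong (_* f zero) (δ-diag {suc n} zero)) (ℤ.*-identityˡ (f zero)))
                     (∑-zero (λ x → cong (_* f (suc x)) (δ-off {e = zero} {suc x} (λ ())))))
          (ℤ.+-identityʳ (f zero))
  ∑-δ {suc n} (suc a) f =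
    trans (cong₂ _+_ (cong (_* f zero) (δ-off {e = suc a} {zero} (λ ())))
                     (trans (∑-cong (λ x → cong (_* f (suc x)) (δ-injective suc Fin.suc-injective a x)))
                            (∑-δ a (f ∘ suc))))
          (ℤ.+-identityˡ (f (suc a)))

toℤ : ∀ {n} → Fin n → ℤ
toℤ x = + toℕ x

module Congruence where

  open import Data.Integer.Base using (_+_; _*_; -_; _-_)
  open import Data.Integer.Tactic.RingSolver using (solve-∀)
  open import Relation.Binary.Bundles using (Setoid)
  import Relation.Binary.Reasoning.Setoid as SetoidReasoning

  infix 4 _≡_mod_
  record _≡_mod_ (a b n : ℤ) : Set where
    constructor congruent
    field
      multiplier : ℤ
      equation : a ≡ b + multiplier * n
  open _≡_mod_ public

  module _ {n : ℤ} where

    ≡⇒≡-mod : ∀ {a b} → a ≡ b → a ≡ b mod n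
    ≡⇒≡-mod {a} refl = congruent (+ 0) (lemma a n)
      where lemma : ∀ a n → a ≡ a + + 0 * n
            lemma = solve-∀

    mod-refl : ∀ {a} → a ≡ a mod n
    mod-refl = ≡⇒≡-mod refl

    mod-sym : ∀ {a b} → a ≡ b mod n → b ≡ a mod n
    mod-sym {a} {b} (congruent q eq) = congruent (- q) (trans (lemma b q n) (cong (_+ - q * n) (sym eq)))
      where lemma : ∀ b q n → b ≡ b + q * n + - q * n
            lemma = solve-∀

    mod-trans : ∀ {a b c} → a ≡ b mod n → b ≡ c mod n → a ≡ c mod n
    mod-trans {c = c} (congruent q refl) (congruent r refl) = congruent (r + q) (lemma c q r n)
      where lemma : ∀ c q r n → c + r * n + q * n ≡ c + (r + q) * n
            lemma = solve-∀

    +-cong-mod : ∀ {a a′ b b′} → a ≡ a′ mod n → b ≡ b′ mod n → a + b ≡ a′ + b′ mod n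
    +-cong-mod {a′ = a} {b′ = b} (congruent q refl) (congruent r refl) = congruent (q + r) (lemma a b q r n)
      where lemma : ∀ a b q r n → a + q * n + (b + r * n) ≡ a + b + (q + r) * n
            lemma = solve-∀

    neg-cong-mod : ∀ {a a′} → a ≡ a′ mod n → - a ≡ - a′ mod n
    neg-cong-mod {a′ = a} (congruent q refl) = congruent (- q) (lemma a q n)
      where lemma : ∀ a q n → - (a + q * n) ≡ - a + - q * n
            lemma = solve-∀

    *-cong-mod : ∀ {a a′ b b′} → a ≡ a′ mod n → b ≡ b′ mod n → a * b ≡ a′ * b′ mod n
    *-cong-mod {a′ = a} {b′ = b} (congruent q refl) (congruent r refl) =
      congruent (q * b + a * r + q * r * n) (lemma a b q r n)
      where lemma : ∀ a b q r n → (a + q * n) * (b + r * n) ≡ a * b + (q * b + a * r + q * r * n) * n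
            lemma = solve-∀

    *ʳ-scale-mod : ∀ c {a b} → a ≡ b mod n → a * c ≡ b * c mod n * c
    *ʳ-scale-mod c {b = b} (congruent q refl) = congruent q (lemma b q n c)
      where lemma : ∀ b q n c → (b + q * n) * c ≡ b * c + q * (n * c)
            lemma = solve-∀

    n≡0-mod : n ≡ + 0 mod n
    n≡0-mod = congruent (+ 1) (lemma n)
      where lemma : ∀ n → n ≡ + 0 + + 1 * n
            lemma = solve-∀

  *-cancelˡ-≡0-mod : ∀ c {a n} → c ≢ + 0 → c * a ≡ + 0 mod c * n → a ≡ + 0 mod n
  *-cancelˡ-≡0-mod c {a} {n} c≢0 (congruent q eq) =
    congruent q (ℤ.*-cancelˡ-≡ c a (+ 0 + q * n) {{ℤ.≢-nonZero c≢0}} (trans eq (lemma c q n)))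
    where lemma : ∀ c q n → + 0 + q * (c * n) ≡ c * (+ 0 + q * n)
          lemma = solve-∀

  -≡0⇒≡-mod : ∀ {a b n} → a - b ≡ + 0 mod n → a ≡ b mod n
  -≡0⇒≡-mod {a} {b} (congruent q eq) = congruent q (trans (lemma a b) (trans (cong (_+ b) eq) (lemma′ b q _)))
    where lemma : ∀ a b → a ≡ a - b + b
          lemma = solve-∀
          lemma′ : ∀ b q n → + 0 + q * n + b ≡ b + q * n
          lemma′ = solve-∀

  ∣⇒≡0-mod : ∀ {n a} → n ∣ a → + a ≡ + 0 mod + n
  ∣⇒≡0-mod {n} (divides q refl) = congruent (+ q) (trans (ℤ.pos-* q n) (sym (ℤ.+-identityˡ (+ q * + n))))

  mod-setoid : ℤ → Setoid _ _
  mod-setoid n = record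
    { Carrier = ℤ
    ; _≈_ = λ a b → a ≡ b mod n
    ; isEquivalence = record { refl = mod-refl ; sym = mod-sym ; trans = mod-trans }
    }

  module ≡-mod-Reasoning (n : ℤ) = SetoidReasoning (mod-setoid n)

module Residues (N : ℕ) where

  open import Data.Integer.Base using (-[1+_]; _+_; _*_; -_; _-_; _⊖_)
  open import Data.Integer.DivMod using (_/ℕ_; n%ℕd<d; a≡a%ℕn+[a/ℕn]*n)
  open import Data.Integer.Tactic.RingSolver using (solve-∀)
  open Congruence
  open FiniteSums using (∑-reindex; δ-injective)

  n : ℕ
  n = suc N

  reduce : ℤ → Fin n
  reduce z = Fin.fromℕ< (n%ℕd<d z n)

  toℤ-reduce : ∀ z → toℤ (reduce z) ≡ z mod + n
  toℤ-reduce z = mod-sym (congruent (z /ℕ n)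
    (trans (a≡a%ℕn+[a/ℕn]*n z n) (cong (λ r → + r + (z /ℕ n) * + n) (sym (Fin.toℕ-fromℕ< _)))))

  private
    no-positive-multiple : ∀ {a} b q → a < n → + a ≢ + b + + suc q * + n
    no-positive-multiple {a} b q a<n eq = ℕ.<-irrefl refl (ℕ.<-≤-trans a<n n≤a)
      where
        a≡b+[1+q]n : a ≡ b ℕ.+ suc q ℕ.* n
        a≡b+[1+q]n = ℤ.+-injective (trans eq (trans (cong (_+_ (+ b)) (sym (ℤ.pos-* (suc q) n)))
                                                   (sym (ℤ.pos-+ b (suc q ℕ.* n)))))
        n≤a : n ≤ a
        n≤a = subst (n ≤_) (sym a≡b+[1+q]n)
                (ℕ.≤-trans (ℕ.m≤m+n n (q ℕ.* n)) (ℕ.m≤n+m (n ℕ.+ q ℕ.* n) b))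

  toℤ-injective-mod : ∀ {x y : Fin n} → toℤ x ≡ toℤ y mod + n → x ≡ y
  toℤ-injective-mod (congruent (+ zero) eq) = Fin.toℕ-injective (ℤ.+-injective (trans eq (ℤ.+-identityʳ _)))
  toℤ-injective-mod {x} (congruent (+ suc q) eq) = ⊥-elim (no-positive-multiple _ q (Fin.toℕ<n x) eq)
  toℤ-injective-mod {y = y} x≡y@(congruent -[1+ q ] _) =
    ⊥-elim (no-positive-multiple _ q (Fin.toℕ<n y) (equation (mod-sym x≡y)))

  reduce-cong : ∀ {a b} → a ≡ b mod + n → reduce a ≡ reduce b
  reduce-cong {a} {b} a≡b = toℤ-injective-mod (mod-trans (toℤ-reduce a) (mod-trans a≡b (mod-sym (toℤ-reduce b))))

  reduce-injective : ∀ {a b} → reduce a ≡ reduce b → a ≡ b mod + n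
  reduce-injective {a} {b} eq =
    mod-trans (mod-sym (toℤ-reduce a)) (subst (λ x → toℤ x ≡ b mod + n) (sym eq) (toℤ-reduce b))

  reduce-toℤ : ∀ x → reduce (toℤ x) ≡ x
  reduce-toℤ x = toℤ-injective-mod (toℤ-reduce (toℤ x))

  toℤ-⊕ : ∀ x y → toℤ (x ⊕ y) ≡ toℤ x + toℤ y mod + n
  toℤ-⊕ x y = toℤ-reduce (toℤ x + toℤ y)

  toℤ-⊖ : ∀ x → toℤ (⊖ x) ≡ - toℤ x mod + n
  toℤ-⊖ x = mod-trans (toℤ-reduce (+ (n ℕ.∸ toℕ x))) (congruent (+ 1) (begin
    + (n ℕ.∸ toℕ x)        ≡⟨ sym (ℤ.⊖-≥ (ℕ.<⇒≤ (Fin.toℕ<n x))) ⟩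
    n ⊖ toℕ x              ≡⟨ sym (ℤ.m-n≡m⊖n n (toℕ x)) ⟩
    + n - toℤ x            ≡⟨ lemma (+ n) (toℤ x) ⟩
    - toℤ x + + 1 * + n    ∎))
    where
      open ≡-Reasoning
      lemma : ∀ n x → n - x ≡ - x + + 1 * n
      lemma = solve-∀

  infixl 6 _⊕ₑ_ _⊝ₑ_
  data Expr : Set where
    var : Fin n → Expr
    lit : ℤ → Expr
    _⊕ₑ_ : Expr → Expr → Expr
    ⊖ₑ_ : Expr → Expr

  _⊝ₑ_ : Expr → Expr → Expr
  e ⊝ₑ f = e ⊕ₑ ⊖ₑ f

  ⟦_⟧ : Expr → Fin n
  ⟦ var x ⟧ = x
  ⟦ lit z ⟧ = reduce z
  ⟦ e ⊕ₑ f ⟧ = ⟦ e ⟧ ⊕ ⟦ f ⟧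
  ⟦ ⊖ₑ e ⟧ = ⊖ ⟦ e ⟧

  ⟦_⟧ℤ : Expr → ℤ
  ⟦ var x ⟧ℤ = toℤ x
  ⟦ lit z ⟧ℤ = z
  ⟦ e ⊕ₑ f ⟧ℤ = ⟦ e ⟧ℤ + ⟦ f ⟧ℤ
  ⟦ ⊖ₑ e ⟧ℤ = - ⟦ e ⟧ℤ

  toℤ-⟦⟧ : ∀ e → toℤ ⟦ e ⟧ ≡ ⟦ e ⟧ℤ mod + n
  toℤ-⟦⟧ (var x) = mod-refl
  toℤ-⟦⟧ (lit z) = toℤ-reduce z
  toℤ-⟦⟧ (e ⊕ₑ f) = mod-trans (toℤ-⊕ ⟦ e ⟧ ⟦ f ⟧) (+-cong-mod (toℤ-⟦⟧ e) (toℤ-⟦⟧ f))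
  toℤ-⟦⟧ (⊖ₑ e) = mod-trans (toℤ-⊖ ⟦ e ⟧) (neg-cong-mod (toℤ-⟦⟧ e))

  prove : ∀ e f → ⟦ e ⟧ℤ ≡ ⟦ f ⟧ℤ → ⟦ e ⟧ ≡ ⟦ f ⟧
  prove e f eq = toℤ-injective-mod
    (mod-trans (toℤ-⟦⟧ e) (subst (λ z → z ≡ toℤ ⟦ f ⟧ mod + n) (sym eq) (mod-sym (toℤ-⟦⟧ f))))

  toℤ-⊝ : ∀ x y → toℤ (x ⊝ y) ≡ toℤ x - toℤ y mod + n
  toℤ-⊝ x y = toℤ-⟦⟧ (var x ⊝ₑ var y)

  ⊝-⊕-cancel : ∀ x c → (x ⊝ c) ⊕ c ≡ x
  ⊝-⊕-cancel x c = prove ((var x ⊝ₑ var c) ⊕ₑ var c) (var x) (lemma (toℤ x) (toℤ c))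
    where lemma : ∀ x c → x - c + c ≡ x
          lemma = solve-∀

  ⊕-⊝-cancel : ∀ x c → (x ⊕ c) ⊝ c ≡ x
  ⊕-⊝-cancel x c = prove ((var x ⊕ₑ var c) ⊝ₑ var c) (var x) (lemma (toℤ x) (toℤ c))
    where lemma : ∀ x c → x + c - c ≡ x
          lemma = solve-∀

  ⊕-cancelʳ : ∀ c {x y} → x ⊕ c ≡ y ⊕ c → x ≡ y
  ⊕-cancelʳ c {x} {y} eq = trans (sym (⊕-⊝-cancel x c)) (trans (cong (_⊝ c) eq) (⊕-⊝-cancel y c))

  zero-⊕ : ∀ x → zero ⊕ x ≡ x
  zero-⊕ x = prove (var zero ⊕ₑ var x) (var x) (ℤ.+-identityˡ (toℤ x))

  ⊕-⊝-comm : ∀ u c s → (u ⊕ c) ⊝ s ≡ (u ⊝ s) ⊕ c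
  ⊕-⊝-comm u c s = prove ((var u ⊕ₑ var c) ⊝ₑ var s) ((var u ⊝ₑ var s) ⊕ₑ var c) (lemma (toℤ u) (toℤ c) (toℤ s))
    where lemma : ∀ u c s → u + c - s ≡ u - s + c
          lemma = solve-∀

  ⊕-⊝-⊕ : ∀ u c s → (u ⊕ c) ⊝ (s ⊕ c) ≡ u ⊝ s
  ⊕-⊝-⊕ u c s = prove ((var u ⊕ₑ var c) ⊝ₑ (var s ⊕ₑ var c)) (var u ⊝ₑ var s) (lemma (toℤ u) (toℤ c) (toℤ s))
    where lemma : ∀ u c s → u + c - (s + c) ≡ u - s
          lemma = solve-∀

  ⊝-⊝ : ∀ t s c → t ⊝ (s ⊝ c) ≡ (t ⊝ s) ⊕ c
  ⊝-⊝ t s c = prove (var t ⊝ₑ (var s ⊝ₑ var c)) ((var t ⊝ₑ var s) ⊕ₑ var c) (lemma (toℤ t) (toℤ s) (toℤ c))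
    where lemma : ∀ t s c → t - (s - c) ≡ t - s + c
          lemma = solve-∀

  ⊝-zero : ∀ x → x ⊝ zero ≡ x
  ⊝-zero x = prove (var x ⊝ₑ var zero) (var x) (ℤ.+-identityʳ (toℤ x))

  ⊝-self : ∀ x → x ⊝ x ≡ zero
  ⊝-self x = prove (var x ⊝ₑ var x) (var zero) (ℤ.+-inverseʳ (toℤ x))

  ⊖-⊝ : ∀ x y → ⊖ (x ⊝ y) ≡ y ⊝ x
  ⊖-⊝ x y = prove (⊖ₑ (var x ⊝ₑ var y)) (var y ⊝ₑ var x) (lemma (toℤ x) (toℤ y))
    where lemma : ∀ x y → - (x - y) ≡ y - x
          lemma = solve-∀

  δ-⊖-⊝ : ∀ a b t → δ b (⊖ (t ⊝ a)) ≡ δ (a ⊝ b) t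
  δ-⊖-⊝ a b t = trans (sym (δ-injective (a ⊝_) ⊝-injective b (⊖ (t ⊝ a)))) (cong (δ (a ⊝ b)) a⊝⊖[t⊝a]≡t)
    where
      ⊝-involutive : ∀ y → a ⊝ (a ⊝ y) ≡ y
      ⊝-involutive y = prove (var a ⊝ₑ (var a ⊝ₑ var y)) (var y) (lemma (toℤ a) (toℤ y))
        where lemma : ∀ a y → a - (a - y) ≡ y
              lemma = solve-∀
      ⊝-injective : ∀ {x y} → a ⊝ x ≡ a ⊝ y → x ≡ y
      ⊝-injective {x} {y} eq = trans (sym (⊝-involutive x)) (trans (cong (a ⊝_) eq) (⊝-involutive y))
      a⊝⊖[t⊝a]≡t : a ⊝ ⊖ (t ⊝ a) ≡ t
      a⊝⊖[t⊝a]≡t = prove (var a ⊝ₑ ⊖ₑ (var t ⊝ₑ var a)) (var t) (lemma (toℤ a) (toℤ t))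
        where lemma : ∀ a t → a - - (t - a) ≡ t
              lemma = solve-∀

  ∑-translate : ∀ (f : Fin n → ℤ) c → ∑ (λ x → f (x ⊕ c)) ≡ ∑ f
  ∑-translate f c = ∑-reindex f (_⊕ c) (_⊝ c) (λ y → ⊝-⊕-cancel y c) (λ x → ⊕-⊝-cancel x c)

module CyclotomicVanishing where

  open import Data.Integer.Base using (_+_; _*_; _-_)
  open import Data.Nat.DivMod using (_/_; m*n/n≡m)
  open import Data.Nat.Divisibility using (∣⇒≤)
  open import Data.Nat.GCD using (gcd; gcd[m,n]∣m; gcd[m,n]∣n; gcd-GCD; module Bézout)
  open import Data.Nat.Primality using (Prime; prime?; prime⇒nonZero)
  open import Data.Nat.Primality.Factorisation using (factorise)
  open import Data.Nat.ListAction using (product)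
  open import Data.List.Base using ([]; _∷_; foldr)
  open import Data.List.Relation.Unary.All using (_∷_)
  open import Data.List.Relation.Unary.Any using (here; there)
  open import Data.List.Membership.Propositional using (_∈_)
  open import Data.List.Membership.Propositional.Properties using (∈-filter⁺; ∈-upTo⁺)
  open import Data.Integer.Tactic.RingSolver using (solve-∀)
  import Data.Nat.Tactic.RingSolver as ℕ-Solver
  open FiniteSums
  open Congruence

  ≗⇒≈C : ∀ {h} {a b : Cyc h} → (∀ t → a t ≡ b t) → a ≈C b
  ≗⇒≈C {a = a} {b} a≗b t = ∑-zero (λ s → cong (_* _) (trans (cong (_- b s) (a≗b s)) (ℤ.+-inverseʳ (b s))))

  -- ι embeds Z_p in Z_n as the subgroup generated by q, and CosetSumsVanish b says that
  -- b · Σ_j x^(j q) = 0 in Z[C_n].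
  module CosetSums (N p′ q : ℕ) (p*q≡n : suc p′ ℕ.* q ≡ suc N) where

    open Residues N
    private module Zₚ = Residues p′

    p : ℕ
    p = suc p′

    ι : Fin p → Fin n
    ι j = reduce (toℤ j * + q)

    CosetSumsVanish : Cyc n → Set
    CosetSumsVanish b = ∀ u → ∑ (λ j → b (u ⊕ ι j)) ≡ + 0

    *C-vanishʳ : ∀ a b → CosetSumsVanish b → CosetSumsVanish (a *C b)
    *C-vanishʳ a b vanish u = begin
      ∑ (λ j → ∑ (λ s → a s * b ((u ⊕ ι j) ⊝ s)))
        ≡⟨ ∑-cong (λ j → ∑-cong (λ s → cong (λ v → a s * b v) (⊕-⊝-comm u (ι j) s))) ⟩
      ∑ (λ j → ∑ (λ s → a s * b ((u ⊝ s) ⊕ ι j)))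
        ≡⟨ ∑-comm (λ j s → a s * b ((u ⊝ s) ⊕ ι j)) ⟩
      ∑ (λ s → ∑ (λ j → a s * b ((u ⊝ s) ⊕ ι j)))
        ≡⟨ ∑-zero (λ s → trans (*-distribˡ-∑ (a s) (λ j → b ((u ⊝ s) ⊕ ι j)))
                               (trans (cong (a s *_) (vanish (u ⊝ s))) (ℤ.*-zeroʳ (a s)))) ⟩
      + 0 ∎
      where open ≡-Reasoning

    *C-vanishˡ : ∀ a b → CosetSumsVanish a → CosetSumsVanish (a *C b)
    *C-vanishˡ a b vanish u = begin
      ∑ (λ j → ∑ (λ s → a s * b ((u ⊕ ι j) ⊝ s)))
        ≡⟨ ∑-cong (λ j → sym (∑-translate (λ s → a s * b ((u ⊕ ι j) ⊝ s)) (ι j))) ⟩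
      ∑ (λ j → ∑ (λ s → a (s ⊕ ι j) * b ((u ⊕ ι j) ⊝ (s ⊕ ι j))))
        ≡⟨ ∑-cong (λ j → ∑-cong (λ s → cong (λ v → a (s ⊕ ι j) * b v) (⊕-⊝-⊕ u (ι j) s))) ⟩
      ∑ (λ j → ∑ (λ s → a (s ⊕ ι j) * b (u ⊝ s)))
        ≡⟨ ∑-comm (λ j s → a (s ⊕ ι j) * b (u ⊝ s)) ⟩
      ∑ (λ s → ∑ (λ j → a (s ⊕ ι j) * b (u ⊝ s)))
        ≡⟨ ∑-zero (λ s → trans (*-distribʳ-∑ (b (u ⊝ s)) (λ j → a (s ⊕ ι j))) (cong (_* b (u ⊝ s)) (vanish s))) ⟩
      + 0 ∎
      where open ≡-Reasoning

    ι-suc : ∀ u j → u ⊕ ι (j ⊕ Zₚ.reduce (+ 1)) ≡ (u ⊕ ι j) ⊕ reduce (+ q)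
    ι-suc u j = toℤ-injective-mod (begin
      toℤ (u ⊕ ι j′)                   ≈⟨ toℤ-⟦⟧ (var u ⊕ₑ lit (toℤ j′ * + q)) ⟩
      toℤ u + toℤ j′ * + q             ≈⟨ +-cong-mod (mod-refl {a = toℤ u}) j′q≡[j+1]q ⟩
      toℤ u + (toℤ j + + 1) * + q      ≡⟨ lemma (toℤ u) (toℤ j) (+ q) ⟩
      toℤ u + toℤ j * + q + + q        ≈⟨ mod-sym (toℤ-⟦⟧ ((var u ⊕ₑ lit (toℤ j * + q)) ⊕ₑ lit (+ q))) ⟩
      toℤ ((u ⊕ ι j) ⊕ reduce (+ q))   ∎)
      where
        open ≡-mod-Reasoning (+ n)
        j′ = j ⊕ Zₚ.reduce (+ 1)
        j′q≡[j+1]q : toℤ j′ * + q ≡ (toℤ j + + 1) * + q mod + n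
        j′q≡[j+1]q = subst (toℤ j′ * + q ≡ (toℤ j + + 1) * + q mod_)
                           (trans (sym (ℤ.pos-* p q)) (cong +_ p*q≡n))
                           (*ʳ-scale-mod (+ q) (Zₚ.toℤ-⟦⟧ (Zₚ.var j Zₚ.⊕ₑ Zₚ.lit (+ 1))))
        lemma : ∀ u j q → u + (j + + 1) * q ≡ u + j * q + q
        lemma = solve-∀

    x^q-1-vanish : CosetSumsVanish (δℕ q -C oneC)
    x^q-1-vanish u = begin
      ∑ (λ j → δ g (u ⊕ ι j) - δ zero (u ⊕ ι j))   ≡⟨ ∑-distrib-- (λ j → δ g (u ⊕ ι j)) (λ j → δ zero (u ⊕ ι j)) ⟩
      ∑ (λ j → δ g (u ⊕ ι j)) - Σ₀                 ≡⟨ cong (_- Σ₀) shift ⟩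
      Σ₀ - Σ₀                                      ≡⟨ ℤ.+-inverseʳ Σ₀ ⟩
      + 0                                          ∎
      where
        open ≡-Reasoning
        g = reduce (+ q)
        Σ₀ = ∑ (λ j → δ zero (u ⊕ ι j))
        shift : ∑ (λ j → δ g (u ⊕ ι j)) ≡ Σ₀
        shift = trans (sym (Zₚ.∑-translate (λ j → δ g (u ⊕ ι j)) (Zₚ.reduce (+ 1))))
                      (∑-cong (λ j → trans (cong₂ δ (sym (zero-⊕ g)) (ι-suc u j))
                                           (δ-injective (_⊕ g) (⊕-cancelʳ g) zero (u ⊕ ι j))))

    private
      Factor : ℕ → Cyc n → Cyc n
      Factor r acc = acc *C (δℕ (n / suc r) -C oneC)

    Ψ-vanish : Prime p → CosetSumsVanish (Ψ n)
    Ψ-vanish p-prime = product-vanish _ (∈-filter⁺ (λ r → prime? (suc r) ×-dec (suc r ∣? n)) (∈-upTo⁺ p′<n)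
                                                    (p-prime , divides q (trans (sym p*q≡n) (ℕ.*-comm p q))))
      where
        n/p≡q : n / p ≡ q
        n/p≡q = trans (cong (_/ p) (trans (sym p*q≡n) (ℕ.*-comm p q))) (m*n/n≡m q p)
        p′<n : p′ < n
        p′<n = ℕ.<-≤-trans (ℕ.n<1+n p′) (subst (p ≤_) p*q≡n (ℕ.m≤m*n p q {{q-nonZero}}))
          where q-nonZero : ℕ.NonZero q
                q-nonZero = ℕ.≢-nonZero (λ { refl → ℕ.0≢1+n (trans (sym (ℕ.*-zeroʳ p)) p*q≡n) })
        product-vanish : ∀ rs → p′ ∈ rs → CosetSumsVanish (foldr Factor oneC rs)
        product-vanish (r ∷ rs) (here refl) = *C-vanishʳ (foldr Factor oneC rs) (δℕ (n / p) -C oneC)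
          (subst (λ e → CosetSumsVanish (δℕ e -C oneC)) (sym n/p≡q) x^q-1-vanish)
        product-vanish (r ∷ rs) (there p′∈rs) =
          *C-vanishˡ (foldr Factor oneC rs) (δℕ (n / suc r) -C oneC) (product-vanish rs p′∈rs)

    invariant⇒annihilated : Prime p → (B : Cyc n) → (∀ j s → B (s ⊕ ι j) ≡ B s) → ∀ t → (B *C Ψ n) t ≡ + 0
    invariant⇒annihilated p-prime B invariant t = cancel-p (begin
      + p * X                                         ≡⟨ sym (∑-const p X) ⟩
      ∑ (λ (j : Fin p) → X)                           ≡⟨ ∑-cong translated ⟩
      ∑ (λ j → ∑ (λ s → B s * Ψ n ((t ⊝ s) ⊕ ι j)))  ≡⟨ ∑-comm (λ j s → B s * Ψ n ((t ⊝ s) ⊕ ι j)) ⟩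
      ∑ (λ s → ∑ (λ j → B s * Ψ n ((t ⊝ s) ⊕ ι j)))
        ≡⟨ ∑-zero (λ s → trans (*-distribˡ-∑ (B s) (λ j → Ψ n ((t ⊝ s) ⊕ ι j)))
                               (trans (cong (B s *_) (Ψ-vanish p-prime (t ⊝ s))) (ℤ.*-zeroʳ (B s)))) ⟩
      + 0 ∎)
      where
        open ≡-Reasoning
        X = (B *C Ψ n) t
        translated : ∀ j → X ≡ ∑ (λ s → B s * Ψ n ((t ⊝ s) ⊕ ι j))
        translated j = trans (sym (∑-translate (λ s → B s * Ψ n (t ⊝ s)) (⊖ ι j)))
                             (∑-cong (λ s → cong₂ _*_ (B-inv s) (cong (Ψ n) (⊝-⊝ t s (ι j)))))
          where B-inv : ∀ s → B (s ⊝ ι j) ≡ B s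
                B-inv s = trans (sym (invariant j (s ⊝ ι j))) (cong B (⊝-⊕-cancel s (ι j)))
        cancel-p : + p * X ≡ + 0 → X ≡ + 0
        cancel-p pX≡0 with ℤ.i*j≡0⇒i≡0∨j≡0 (+ p) pX≡0
        ... | inj₂ X≡0 = X≡0

  prime-divisor : ∀ d → 1 < d → Σ ℕ λ p → Prime p × p ∣ d
  prime-divisor 1 (ℕ.s≤s ())
  prime-divisor d@(suc (suc _)) _ with factorise d
  ... | record { factors = [] ; isFactorisation = () }
  ... | record { factors = p ∷ ps ; isFactorisation = d≡p*ps ; factorsPrime = p-prime ∷ _ } =
    p , p-prime , divides (product ps) (trans d≡p*ps (ℕ.*-comm p (product ps)))

  bézout-multiplier : ∀ N a → Σ ℕ λ c → + c * + a ≡ + gcd a (suc N) mod + suc N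
  bézout-multiplier N a with Bézout.identity (gcd-GCD a (suc N))
  ... | Bézout.+- x y eq = x , congruent (+ y) (begin
    + x * + a                 ≡⟨ sym (ℤ.pos-* x a) ⟩
    + (x ℕ.* a)               ≡⟨ cong +_ (sym eq) ⟩
    + (g ℕ.+ y ℕ.* suc N)     ≡⟨ ℤ.pos-+ g (y ℕ.* suc N) ⟩
    + g + + (y ℕ.* suc N)     ≡⟨ cong (_+_ (+ g)) (ℤ.pos-* y (suc N)) ⟩
    + g + + y * + suc N       ∎)
    where open ≡-Reasoning
          g = gcd a (suc N)
  -- Here g + x a = y (N + 1), and N ≡ -1, so N x a ≡ - x a ≡ g.
  ... | Bézout.-+ x y eq = N ℕ.* x , congruent (+ x * + a - + y) (begin
    + (N ℕ.* x) * + a                                   ≡⟨ cong (_* + a) (ℤ.pos-* N x) ⟩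
    + N * + x * + a                                     ≡⟨ lemma (+ N) (+ x) (+ a) (+ g) (+ y) ⟩
    + g + (+ x * + a - + y) * + suc N + (yn - (+ g + + x * + a))
                                                        ≡⟨ cong (λ e → + g + (+ x * + a - + y) * + suc N + (yn - e)) eq′ ⟩
    + g + (+ x * + a - + y) * + suc N + (yn - yn)       ≡⟨ cong (_+_ (+ g + (+ x * + a - + y) * + suc N)) (ℤ.+-inverseʳ yn) ⟩
    + g + (+ x * + a - + y) * + suc N + + 0             ≡⟨ ℤ.+-identityʳ _ ⟩
    + g + (+ x * + a - + y) * + suc N                   ∎)
    where
      open ≡-Reasoning
      g = gcd a (suc N)
      yn = + y * + suc N
      eq′ : + g + + x * + a ≡ yn
      eq′ = trans (cong (_+_ (+ g)) (sym (ℤ.pos-* x a)))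
                  (trans (sym (ℤ.pos-+ g (x ℕ.* a))) (trans (cong +_ eq) (ℤ.pos-* y (suc N))))
      lemma : ∀ N x a g y → N * x * a ≡ g + (x * a - y) * (+ 1 + N) + (y * (+ 1 + N) - (g + x * a))
      lemma = solve-∀

  gcd-cofactor>1 : ∀ {a n d} → 0 < a → a < n → n ≡ d ℕ.* gcd a n → 1 < d
  gcd-cofactor>1 {d = zero} _ a<n refl = ⊥-elim (ℕ.n≮0 a<n)
  gcd-cofactor>1 {a} {n} {d = 1} 0<a a<n n≡g = ⊥-elim (ℕ.<-irrefl refl (ℕ.<-≤-trans a<n n≤a))
    where n≤a : n ≤ a
          n≤a = subst (_≤ a) (sym (trans n≡g (ℕ.*-identityˡ _))) (∣⇒≤ {{ℕ.>-nonZero 0<a}} (gcd[m,n]∣m a n))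
  gcd-cofactor>1 {d = suc (suc _)} _ _ _ = ℕ.s≤s (ℕ.s≤s ℕ.z≤n)

  record MultipleOfPrimeOrder (N a : ℕ) : Set where
    field
      p′ q k : ℕ
      prime : Prime (suc p′)
      p*q≡n : suc p′ ℕ.* q ≡ suc N
      k*a≡q : + k * + a ≡ + q mod + suc N

  -- With g = gcd a n and n = d g, a prime p ∣ d gives q = n/p = (d/p) g, a multiple of g and so,
  -- by Bézout, of a.
  multipleOfPrimeOrder : ∀ N a → 0 < a → a < suc N → MultipleOfPrimeOrder N a
  multipleOfPrimeOrder N a 0<a a<n with gcd[m,n]∣n a (suc N)
  ... | divides d n≡d*g with prime-divisor d (gcd-cofactor>1 0<a a<n n≡d*g)
  ... | zero , zero-prime , _ = ⊥-elim (ℕ.NonZero.nonZero (prime⇒nonZero zero-prime))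
  ... | suc p′ , p-prime , divides r d≡r*p = record
    { p′ = p′ ; q = r ℕ.* g ; k = c ℕ.* r ; prime = p-prime
    ; p*q≡n = trans (lemma (suc p′) r g) (sym (trans n≡d*g (cong (ℕ._* g) d≡r*p)))
    ; k*a≡q = begin
        + (c ℕ.* r) * + a  ≡⟨ cong (_* + a) (ℤ.pos-* c r) ⟩
        + c * + r * + a    ≡⟨ ℤ-lemma (+ c) (+ r) (+ a) ⟩
        + c * + a * + r    ≈⟨ *-cong-mod c*a≡g mod-refl ⟩
        + g * + r           ≡⟨ trans (ℤ.*-comm (+ g) (+ r)) (sym (ℤ.pos-* r g)) ⟩
        + (r ℕ.* g)         ∎
    }
    where
      open ≡-mod-Reasoning (+ suc N)
      g = gcd a (suc N)
      c = proj₁ (bézout-multiplier N a)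
      c*a≡g = proj₂ (bézout-multiplier N a)
      lemma : ∀ p r g → p ℕ.* (r ℕ.* g) ≡ r ℕ.* p ℕ.* g
      lemma = ℕ-Solver.solve-∀
      ℤ-lemma : ∀ j r a → j * r * a ≡ j * a * r
      ℤ-lemma = solve-∀

  translation-invariant⇒≈0 : ∀ {N} (B : Cyc (suc N)) (a : Fin (suc N)) → a ≢ zero →
                              (∀ t → B (t ⊕ a) ≡ B t) → B ≈C 0C
  translation-invariant⇒≈0 {N} B a a≢0 invariant = invariant⇒annihilated prime (B -C 0C) ι-invariant
    where
      open Residues N
      0<a : 0 < toℕ a
      0<a = ℕ.n≢0⇒n>0 (λ a≡0 → a≢0 (Fin.toℕ-injective a≡0))
      open MultipleOfPrimeOrder (multipleOfPrimeOrder N (toℕ a) 0<a (Fin.toℕ<n a))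
      open CosetSums N p′ q p*q≡n
      multiples : ∀ c s → B (s ⊕ reduce (+ c * toℤ a)) ≡ B s
      multiples zero s = cong B (prove (var s ⊕ₑ lit (+ 0 * toℤ a)) (var s) (lemma₀ (toℤ s) (toℤ a)))
        where lemma₀ : ∀ s a → s + + 0 * a ≡ s
              lemma₀ = solve-∀
      multiples (suc c) s = trans (cong B step) (trans (invariant _) (multiples c s))
        where
          lemma₁ : ∀ s c a → s + (+ 1 + c) * a ≡ s + c * a + a
          lemma₁ = solve-∀
          step : s ⊕ reduce (+ suc c * toℤ a) ≡ (s ⊕ reduce (+ c * toℤ a)) ⊕ a
          step = prove (var s ⊕ₑ lit (+ suc c * toℤ a)) ((var s ⊕ₑ lit (+ c * toℤ a)) ⊕ₑ var a)
                       (lemma₁ (toℤ s) (+ c) (toℤ a))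
      ι≡multiple : ∀ j → ι j ≡ reduce (+ (toℕ j ℕ.* k) * toℤ a)
      ι≡multiple j = reduce-cong (mod-sym (begin
        + (toℕ j ℕ.* k) * toℤ a   ≡⟨ trans (cong (_* toℤ a) (ℤ.pos-* (toℕ j) k)) (ℤ.*-assoc (toℤ j) (+ k) (toℤ a)) ⟩
        toℤ j * (+ k * toℤ a)     ≈⟨ *-cong-mod (mod-refl {a = toℤ j}) k*a≡q ⟩
        toℤ j * + q               ∎))
        where open ≡-mod-Reasoning (+ n)
      ι-invariant : ∀ j s → (B -C 0C) (s ⊕ ι j) ≡ (B -C 0C) s
      ι-invariant j s = cong (_- + 0) (trans (cong (λ x → B (s ⊕ x)) (ι≡multiple j)) (multiples (toℕ j ℕ.* k) s))

module Monomials where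

  open import Data.Integer.Base using (_*_)
  open FiniteSums

  powerSum : ∀ {m h} → (Fin m → Fin h) → Cyc h
  powerSum f t = ∑ (λ x → δ (f x) t)

  monomial : ∀ {m h} → (Fin m → Fin h) → GR m h
  monomial E x = δ (E x)

  module _ {M N : ℕ} where

    private
      module Zₘ = Residues M
      module Zₕ = Residues N

    powerSum-shift : ∀ {f f′ : Fin (suc M) → Fin (suc N)} a → (∀ x → f′ x ≡ f x ⊕ a) →
                     ∀ t → powerSum f′ (t ⊕ a) ≡ powerSum f t
    powerSum-shift {f} a f′≡f⊕a t =
      ∑-cong (λ x → trans (cong (λ e → δ e (t ⊕ a)) (f′≡f⊕a x)) (δ-injective (_⊕ a) (Zₕ.⊕-cancelʳ a) (f x) t))

    powerSum-invariant : ∀ (f : Fin (suc M) → Fin (suc N)) c a → (∀ x → f (x ⊕ c) ≡ f x ⊕ a) →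
                         ∀ t → powerSum f (t ⊕ a) ≡ powerSum f t
    powerSum-invariant f c a f-shift t =
      trans (sym (Zₘ.∑-translate (λ x → δ (f x) (t ⊕ a)) c)) (powerSum-shift {f = f} a f-shift t)

    correlation : ∀ (E E′ : Fin (suc M) → Fin (suc N)) g t →
                  (monomial E *G (monomial E′ ⁻¹G)) g t ≡ powerSum (λ x → E x ⊝ E′ (x ⊝ g)) t
    correlation E E′ g t = ∑-cong (λ x → begin
      ∑ (λ s → δ (E x) s * δ (E′ (⊖ (g ⊝ x))) (⊖ (t ⊝ s)))  ≡⟨ ∑-δ (E x) (λ s → δ (E′ (⊖ (g ⊝ x))) (⊖ (t ⊝ s))) ⟩
      δ (E′ (⊖ (g ⊝ x))) (⊖ (t ⊝ E x))                    ≡⟨ cong (λ y → δ (E′ y) (⊖ (t ⊝ E x))) (Zₘ.⊖-⊝ g x) ⟩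
      δ (E′ (x ⊝ g)) (⊖ (t ⊝ E x))                        ≡⟨ Zₕ.δ-⊖-⊝ (E x) (E′ (x ⊝ g)) t ⟩
      δ (E x ⊝ E′ (x ⊝ g)) t                              ∎)
      where open ≡-Reasoning

record Parameters (h m k : ℕ) : Set where
  field
    R L β C : ℕ
    R*m≡h : R ℕ.* m ≡ h
    L*k≡m : L ℕ.* k ≡ m
    h∣2βL : h ∣ 2 ℕ.* β ℕ.* L
    h∣2βm : h ∣ 2 ℕ.* β ℕ.* m
    h∣βmm : h ∣ β ℕ.* m ℕ.* m
    2β≡Rk+Ch : 2 ℕ.* β ≡ R ℕ.* k ℕ.+ C ℕ.* h

OrthogonalFamily : (k m h n : ℕ) → Set
OrthogonalFamily k m h n =
  Σ (Fin k → GR m h) λ D →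
    (∀ i g → Σ (Fin h) λ e → D i g ≈C δ e) ×
    (∀ i j → i ≢ j → (D i *G (D j ⁻¹G)) ≈G 0G) ×
    (∑G (λ i → D i *G (D i ⁻¹G)) ≈G ιG (+ n))

module Construction {N m′ k′ : ℕ} (params : Parameters (suc N) (suc m′) (suc k′)) where

  open import Data.Integer.Base using (_+_; _*_; _-_)
  open import Data.Integer.Tactic.RingSolver using (solve-∀)
  open Parameters params
  open Congruence
  open FiniteSums
  open Monomials
  open CyclotomicVanishing using (translation-invariant⇒≈0; ≗⇒≈C)
  open Residues N renaming (n to h)
  private
    module Zₘ = Residues m′
    module Zₖ = Residues k′

  m k : ℕ
  m = suc m′
  k = suc k′

  exponent : ℤ → ℤ → ℤ
  exponent I X = + R * I * X + + β * X * X

  E : Fin k → Fin m → Fin h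
  E i x = reduce (exponent (toℤ i) (toℤ x))

  D : Fin k → GR m h
  D i = monomial (E i)

  private
    pos-*³ : ∀ a b c → + (a ℕ.* b ℕ.* c) ≡ + a * + b * + c
    pos-*³ a b c = trans (ℤ.pos-* (a ℕ.* b) c) (cong (_* + c) (ℤ.pos-* a b))

    h≡Rm : + h ≡ + R * + m
    h≡Rm = trans (cong +_ (sym R*m≡h)) (ℤ.pos-* R m)

    m≡Lk : + m ≡ + L * + k
    m≡Lk = trans (cong +_ (sym L*k≡m)) (ℤ.pos-* L k)

    Rm≡0 : + R * + m ≡ + 0 mod + h
    Rm≡0 = subst (_≡ + 0 mod + h) h≡Rm n≡0-mod

    2βL≡0 : + 2 * + β * + L ≡ + 0 mod + h
    2βL≡0 = subst (_≡ + 0 mod + h) (pos-*³ 2 β L) (∣⇒≡0-mod h∣2βL)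

    2βm≡0 : + 2 * + β * + m ≡ + 0 mod + h
    2βm≡0 = subst (_≡ + 0 mod + h) (pos-*³ 2 β m) (∣⇒≡0-mod h∣2βm)

    βmm≡0 : + β * + m * + m ≡ + 0 mod + h
    βmm≡0 = subst (_≡ + 0 mod + h) (pos-*³ β m m) (∣⇒≡0-mod h∣βmm)

    2β≡Rk : + 2 * + β ≡ + R * + k mod + h
    2β≡Rk = congruent (+ C) (begin
      + 2 * + β                  ≡⟨ sym (ℤ.pos-* 2 β) ⟩
      + (2 ℕ.* β)                ≡⟨ cong +_ 2β≡Rk+Ch ⟩
      + (R ℕ.* k ℕ.+ C ℕ.* h)    ≡⟨ ℤ.pos-+ (R ℕ.* k) (C ℕ.* h) ⟩
      + (R ℕ.* k) + + (C ℕ.* h)  ≡⟨ cong₂ _+_ (ℤ.pos-* R k) (ℤ.pos-* C h) ⟩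
      + R * + k + + C * + h      ∎)
      where open ≡-Reasoning

  exponent-cong : ∀ I {X X′} → X ≡ X′ mod + m → exponent I X ≡ exponent I X′ mod + h
  exponent-cong I {X′ = X} (congruent q refl) = begin
    exponent I (X + q * + m)
      ≡⟨ expand (+ R) (+ β) I X q (+ m) ⟩
    exponent I X + (+ R * + m * (I * q) + + 2 * + β * + m * (X * q) + + β * + m * + m * (q * q))
      ≈⟨ +-cong-mod (mod-refl {a = exponent I X})
           (+-cong-mod (+-cong-mod (*-cong-mod Rm≡0 (mod-refl {a = I * q})) (*-cong-mod 2βm≡0 (mod-refl {a = X * q})))
                       (*-cong-mod βmm≡0 (mod-refl {a = q * q}))) ⟩
    exponent I X + (+ 0 * (I * q) + + 0 * (X * q) + + 0 * (q * q))
      ≡⟨ collapse (exponent I X) (I * q) (X * q) (q * q) ⟩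
    exponent I X ∎
    where
      open ≡-mod-Reasoning (+ h)
      expand : ∀ R β I X q m → R * I * (X + q * m) + β * (X + q * m) * (X + q * m) ≡
                 (R * I * X + β * X * X) + (R * m * (I * q) + + 2 * β * m * (X * q) + β * m * m * (q * q))
      expand = solve-∀
      collapse : ∀ e a b c → e + (+ 0 * a + + 0 * b + + 0 * c) ≡ e
      collapse = solve-∀

  toℤ-E : ∀ i {x X} → toℤ x ≡ X mod + m → toℤ (E i x) ≡ exponent (toℤ i) X mod + h
  toℤ-E i x≡X = mod-trans (toℤ-reduce _) (exponent-cong (toℤ i) x≡X)

  Δ : ℤ → ℤ → ℤ → ℤ → ℤ
  Δ I J G X = exponent I X - exponent J (X - G)

  F : Fin k → Fin k → Fin m → Fin m → Fin h
  F i j g x = E i x ⊝ E j (x ⊝ g)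

  toℤ-F : ∀ i j g x {X} → toℤ x ≡ X mod + m → toℤ (F i j g x) ≡ Δ (toℤ i) (toℤ j) (toℤ g) X mod + h
  toℤ-F i j g x x≡X = mod-trans (toℤ-⊝ (E i x) (E j (x ⊝ g)))
    (+-cong-mod (toℤ-E i x≡X) (neg-cong-mod (toℤ-E j (mod-trans (Zₘ.toℤ-⊝ x g) (+-cong-mod x≡X mod-refl)))))

  F-shift : ∀ i j g x s →
            F i j g (x ⊕ Zₘ.reduce s) ≡ F i j g x ⊕ reduce (+ R * s * (toℤ i - toℤ j) + + 2 * + β * s * toℤ g)
  F-shift i j g x s = toℤ-injective-mod (begin
    toℤ (F i j g (x ⊕ Zₘ.reduce s))        ≈⟨ toℤ-F i j g _ (Zₘ.toℤ-⟦⟧ (Zₘ.var x Zₘ.⊕ₑ Zₘ.lit s)) ⟩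
    Δ I J G (X + s)                        ≡⟨ Δ-shift (+ R) (+ β) I J G X s ⟩
    Δ I J G X + shift                      ≈⟨ mod-sym (+-cong-mod (toℤ-F i j g x mod-refl) (toℤ-reduce shift)) ⟩
    toℤ (F i j g x) + toℤ (reduce shift)   ≈⟨ mod-sym (toℤ-⊕ (F i j g x) (reduce shift)) ⟩
    toℤ (F i j g x ⊕ reduce shift)         ∎)
    where
      open ≡-mod-Reasoning (+ h)
      I = toℤ i
      J = toℤ j
      G = toℤ g
      X = toℤ x
      shift = + R * s * (I - J) + + 2 * + β * s * G
      Δ-shift : ∀ R β I J G X s →
                (R * I * (X + s) + β * (X + s) * (X + s)) - (R * J * (X + s - G) + β * (X + s - G) * (X + s - G)) ≡
                (R * I * X + β * X * X) - (R * J * (X - G) + β * (X - G) * (X - G)) + (R * s * (I - J) + + 2 * β * s * G)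
      Δ-shift = solve-∀

  R*I*G-cong : ∀ {I I′} G → + R * + k * G ≡ + 0 mod + h → I ≡ I′ mod + k → + R * I * G ≡ + R * I′ * G mod + h
  R*I*G-cong {I′ = I} G RkG≡0 (congruent q refl) = begin
    + R * (I + q * + k) * G                 ≡⟨ expand (+ R) I q (+ k) G ⟩
    + R * I * G + q * (+ R * + k * G)       ≈⟨ +-cong-mod (mod-refl {a = + R * I * G}) (*-cong-mod (mod-refl {a = q}) RkG≡0) ⟩
    + R * I * G + q * + 0                   ≡⟨ cong (_+_ (+ R * I * G)) (ℤ.*-zeroʳ q) ⟩
    + R * I * G + + 0                       ≡⟨ ℤ.+-identityʳ _ ⟩
    + R * I * G                             ∎
    where
      open ≡-mod-Reasoning (+ h)
      expand : ∀ R I q k G → R * (I + q * k) * G ≡ R * I * G + q * (R * k * G)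
      expand = solve-∀

  F-diag-suc : ∀ i g x → + R * + k * toℤ g ≡ + 0 mod + h →
               F (i ⊕ Zₖ.reduce (+ 1)) (i ⊕ Zₖ.reduce (+ 1)) g x ≡ F i i g x ⊕ reduce (+ R * toℤ g)
  F-diag-suc i g x RkG≡0 = toℤ-injective-mod (begin
    toℤ (F i′ i′ g x)                          ≈⟨ toℤ-F i′ i′ g x mod-refl ⟩
    Δ I′ I′ G X                                ≡⟨ Δ-diag (+ R) (+ β) I′ G X ⟩
    + R * I′ * G + rest                        ≈⟨ +-cong-mod (R*I*G-cong G RkG≡0 I′≡I+1) (mod-refl {a = rest}) ⟩
    + R * (I + + 1) * G + rest                 ≡⟨ Δ-diag-suc (+ R) (+ β) I G X ⟩
    Δ I I G X + + R * G                        ≈⟨ mod-sym (+-cong-mod (toℤ-F i i g x mod-refl) (toℤ-reduce (+ R * G))) ⟩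
    toℤ (F i i g x) + toℤ (reduce (+ R * G))   ≈⟨ mod-sym (toℤ-⊕ (F i i g x) (reduce (+ R * G))) ⟩
    toℤ (F i i g x ⊕ reduce (+ R * G))         ∎)
    where
      open ≡-mod-Reasoning (+ h)
      i′ = i ⊕ Zₖ.reduce (+ 1)
      I = toℤ i
      I′ = toℤ i′
      G = toℤ g
      X = toℤ x
      rest = + β * (+ 2 * X * G - G * G)
      I′≡I+1 : I′ ≡ I + + 1 mod + k
      I′≡I+1 = Zₖ.toℤ-⟦⟧ (Zₖ.var i Zₖ.⊕ₑ Zₖ.lit (+ 1))
      Δ-diag : ∀ R β I G X → (R * I * X + β * X * X) - (R * I * (X - G) + β * (X - G) * (X - G)) ≡
                             R * I * G + β * (+ 2 * X * G - G * G)
      Δ-diag = solve-∀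
      Δ-diag-suc : ∀ R β I G X → R * (I + + 1) * G + β * (+ 2 * X * G - G * G) ≡
                                 (R * I * X + β * X * X) - (R * I * (X - G) + β * (X - G) * (X - G)) + R * G
      Δ-diag-suc = solve-∀

  private
    R≢0 : + R ≢ + 0
    R≢0 R≡0 = ℕ.0≢1+n (sym (ℤ.+-injective (trans h≡Rm (cong (_* + m) R≡0))))

    RL≢0 : + R * + L ≢ + 0
    RL≢0 RL≡0 with ℤ.i*j≡0⇒i≡0∨j≡0 (+ R) RL≡0
    ... | inj₁ R≡0 = R≢0 R≡0
    ... | inj₂ L≡0 = ℕ.0≢1+n (sym (ℤ.+-injective (trans m≡Lk (cong (_* + k) L≡0))))

    reduce≡zero : ∀ {a} → reduce a ≡ zero → a ≡ + 0 mod + h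
    reduce≡zero {a} eq = reduce-injective (trans eq (sym (reduce-toℤ zero)))

  RL-shift-nonzero : ∀ i j → i ≢ j → reduce (+ R * + L * (toℤ i - toℤ j)) ≢ zero
  RL-shift-nonzero i j i≢j eq = i≢j (Zₖ.toℤ-injective-mod (-≡0⇒≡-mod (*-cancelˡ-≡0-mod (+ R * + L) RL≢0
    (subst (λ n → + R * + L * (toℤ i - toℤ j) ≡ + 0 mod n) h≡RLk (reduce≡zero eq)))))
    where h≡RLk : + h ≡ + R * + L * + k
          h≡RLk = trans h≡Rm (trans (cong (+ R *_) m≡Lk) (sym (ℤ.*-assoc (+ R) (+ L) (+ k))))

  R-shift-nonzero : ∀ g → g ≢ zero → reduce (+ R * toℤ g) ≢ zero
  R-shift-nonzero g g≢0 eq = g≢0 (Zₘ.toℤ-injective-mod (*-cancelˡ-≡0-mod (+ R) R≢0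
    (subst (λ n → + R * toℤ g ≡ + 0 mod n) h≡Rm (reduce≡zero eq))))

  orthogonal : ∀ i j → i ≢ j → (D i *G (D j ⁻¹G)) ≈G 0G
  orthogonal i j i≢j g =
    translation-invariant⇒≈0 (λ t → (D i *G (D j ⁻¹G)) g t) a (RL-shift-nonzero i j i≢j) invariant
    where
      a = reduce (+ R * + L * (toℤ i - toℤ j))
      shift-by-L : ∀ x → F i j g (x ⊕ Zₘ.reduce (+ L)) ≡ F i j g x ⊕ a
      shift-by-L x = trans (F-shift i j g x (+ L)) (cong (F i j g x ⊕_) (reduce-cong (begin
        + R * + L * (toℤ i - toℤ j) + + 2 * + β * + L * toℤ g
          ≈⟨ +-cong-mod (mod-refl {a = + R * + L * (toℤ i - toℤ j)}) (*-cong-mod 2βL≡0 (mod-refl {a = toℤ g})) ⟩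
        + R * + L * (toℤ i - toℤ j) + + 0
          ≡⟨ ℤ.+-identityʳ _ ⟩
        + R * + L * (toℤ i - toℤ j) ∎)))
        where open ≡-mod-Reasoning (+ h)
      invariant : ∀ t → (D i *G (D j ⁻¹G)) g (t ⊕ a) ≡ (D i *G (D j ⁻¹G)) g t
      invariant t = trans (correlation (E i) (E j) g (t ⊕ a))
                          (trans (powerSum-invariant (F i j g) (Zₘ.reduce (+ L)) a shift-by-L t)
                                 (sym (correlation (E i) (E j) g t)))

  autocorrelation : Fin m → Cyc h
  autocorrelation g = ∑G (λ i → D i *G (D i ⁻¹G)) g

  autocorrelation-powerSums : ∀ g t → autocorrelation g t ≡ ∑ (λ i → powerSum (F i i g) t)
  autocorrelation-powerSums g t = ∑-cong (λ i → correlation (E i) (E i) g t)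

  autocorrelation-zero : ∀ t → autocorrelation zero t ≡ ιC (+ (m ℕ.* k)) t
  autocorrelation-zero t = begin
    autocorrelation zero t                          ≡⟨ autocorrelation-powerSums zero t ⟩
    ∑ (λ i → ∑ (λ x → δ (F i i zero x) t))          ≡⟨ ∑-cong (λ i → ∑-cong (λ x → cong (λ e → δ e t) (F-zero i x))) ⟩
    ∑ (λ (i : Fin k) → ∑ (λ (x : Fin m) → δ zero t)) ≡⟨ ∑-cong {k} (λ i → ∑-const m (δ zero t)) ⟩
    ∑ (λ (i : Fin k) → + m * δ zero t)              ≡⟨ ∑-const k (+ m * δ zero t) ⟩
    + k * (+ m * δ zero t)                          ≡⟨ lemma (+ k) (+ m) (δ zero t) ⟩
    + m * + k * δ zero t                            ≡⟨ cong (_* δ zero t) (sym (ℤ.pos-* m k)) ⟩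
    + (m ℕ.* k) * δ zero t                          ∎
    where
      open ≡-Reasoning
      F-zero : ∀ i x → F i i zero x ≡ zero
      F-zero i x = trans (cong (λ y → E i x ⊝ E i y) (Zₘ.⊝-zero x)) (⊝-self (E i x))
      lemma : ∀ k m d → k * (m * d) ≡ m * k * d
      lemma = solve-∀

  autocorrelation-shift-x : ∀ g t → autocorrelation g (t ⊕ reduce (+ R * + k * toℤ g)) ≡ autocorrelation g t
  autocorrelation-shift-x g t = begin
    autocorrelation g (t ⊕ a)                  ≡⟨ autocorrelation-powerSums g (t ⊕ a) ⟩
    ∑ (λ i → powerSum (F i i g) (t ⊕ a))
      ≡⟨ ∑-cong (λ i → powerSum-invariant (F i i g) (Zₘ.reduce (+ 1)) a (shift-by-1 i) t) ⟩
    ∑ (λ i → powerSum (F i i g) t)             ≡⟨ sym (autocorrelation-powerSums g t) ⟩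
    autocorrelation g t                        ∎
    where
      open ≡-Reasoning
      a = reduce (+ R * + k * toℤ g)
      shift-by-1 : ∀ i x → F i i g (x ⊕ Zₘ.reduce (+ 1)) ≡ F i i g x ⊕ a
      shift-by-1 i x = trans (F-shift i i g x (+ 1)) (cong (F i i g x ⊕_) (reduce-cong
        (mod-trans (≡⇒≡-mod (lemma (+ R) (+ β) (toℤ i) (toℤ g))) (*-cong-mod 2β≡Rk (mod-refl {a = toℤ g})))))
        where lemma : ∀ R β I G → R * + 1 * (I - I) + + 2 * β * + 1 * G ≡ + 2 * β * G
              lemma = solve-∀

  autocorrelation-shift-i : ∀ g → + R * + k * toℤ g ≡ + 0 mod + h →
                            ∀ t → autocorrelation g (t ⊕ reduce (+ R * toℤ g)) ≡ autocorrelation g t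
  autocorrelation-shift-i g RkG≡0 t = begin
    autocorrelation g (t ⊕ a)                                 ≡⟨ autocorrelation-powerSums g (t ⊕ a) ⟩
    ∑ (λ i → powerSum (F i i g) (t ⊕ a))
      ≡⟨ sym (Zₖ.∑-translate (λ i → powerSum (F i i g) (t ⊕ a)) one) ⟩
    ∑ (λ i → powerSum (F (i ⊕ one) (i ⊕ one) g) (t ⊕ a))
      ≡⟨ ∑-cong (λ i → powerSum-shift {f = F i i g} a (λ x → F-diag-suc i g x RkG≡0) t) ⟩
    ∑ (λ i → powerSum (F i i g) t)                            ≡⟨ sym (autocorrelation-powerSums g t) ⟩
    autocorrelation g t                                       ∎
    where
      open ≡-Reasoning
      a = reduce (+ R * toℤ g)
      one = Zₖ.reduce (+ 1)

  autocorrelation-sum : ∑G (λ i → D i *G (D i ⁻¹G)) ≈G ιG (+ (m ℕ.* k))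
  autocorrelation-sum zero = ≗⇒≈C autocorrelation-zero
  autocorrelation-sum g@(suc _) with reduce (+ R * + k * toℤ g) Fin.≟ zero
  ... | no a≢0 = translation-invariant⇒≈0 (autocorrelation g) _ a≢0 (autocorrelation-shift-x g)
  ... | yes a≡0 = translation-invariant⇒≈0 (autocorrelation g) _ (R-shift-nonzero g (λ ()))
                    (autocorrelation-shift-i g (reduce≡zero a≡0))

  construction : OrthogonalFamily k m h (m ℕ.* k)
  construction = D , (λ i g → E i g , ≗⇒≈C {a = D i g} (λ t → refl)) , orthogonal , autocorrelation-sum

open import Data.Nat.Base using (_+_; _*_)
import Data.Nat.Tactic.RingSolver as ℕ-Solver

Minimal : ℕ → ℕ → Set
Minimal n h = ∀ h′ → 0 < h′ → n ∣ h′ * h′ → ¬ (Val2 n 1 × Val2 h′ 1) → h ≤ h′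

even-or-odd : ∀ n → Σ ℕ λ a → n ≡ 2 * a ⊎ n ≡ 1 + 2 * a
even-or-odd zero = 0 , inj₁ refl
even-or-odd (suc n) with even-or-odd n
... | a , inj₁ n≡2a = a , inj₂ (cong suc n≡2a)
... | a , inj₂ n≡1+2a = suc a , inj₁ (trans (cong suc n≡1+2a) (lemma a))
  where lemma : ∀ a → suc (1 + 2 * a) ≡ 2 * suc a
        lemma = ℕ-Solver.solve-∀

twice-odd⇒Val2-1 : ∀ {n} w → n ≡ 2 * (1 + 2 * w) → Val2 n 1
twice-odd⇒Val2-1 {n} w refl = divides (1 + 2 * w) (ℕ.*-comm 2 (1 + 2 * w)) , ¬4∣n
  where ¬4∣n : ¬ (4 ∣ n)
        ¬4∣n (divides q eq) = ℕ.even≢odd q w (sym (ℕ.*-cancelˡ-≡ (1 + 2 * w) (2 * q) 2 (trans eq (lemma q))))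
          where lemma : ∀ q → q * 4 ≡ 2 * (2 * q)
                lemma = ℕ-Solver.solve-∀

even∧¬Val2-1⇒4∣ : ∀ {h} → 2 ∣ h → ¬ Val2 h 1 → 4 ∣ h
even∧¬Val2-1⇒4∣ {h} 2∣h ν₂h≢1 with 4 ∣? h
... | yes 4∣h = 4∣h
... | no ¬4∣h = ⊥-elim (ν₂h≢1 (2∣h , ¬4∣h))

odd∣2x⇒∣x : ∀ {k x} b → k ≡ 1 + 2 * b → k ∣ 2 * x → k ∣ x
odd∣2x⇒∣x {k} {x} b k≡1+2b (divides y 2x≡yk) with even-or-odd y
... | z , inj₁ y≡2z = divides z (ℕ.*-cancelˡ-≡ x (z * k) 2 (trans 2x≡yk (trans (cong (_* k) y≡2z) (ℕ.*-assoc 2 z k))))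
... | z , inj₂ y≡1+2z = ⊥-elim (ℕ.even≢odd x (z + b + 2 * z * b)
        (trans 2x≡yk (trans (cong₂ _*_ y≡1+2z k≡1+2b) (lemma z b))))
  where lemma : ∀ z b → (1 + 2 * z) * (1 + 2 * b) ≡ suc (2 * (z + b + 2 * z * b))
        lemma = ℕ-Solver.solve-∀

parameters-m≡h : ∀ {h k} c β C → h ≡ c * k → 2 * β ≡ k + C * h → Parameters h h k
parameters-m≡h {h} {k} c β C h≡ck 2β≡k+Ch = record
  { R = 1 ; L = c ; β = β ; C = C
  ; R*m≡h = ℕ.*-identityˡ h
  ; L*k≡m = sym h≡ck
  ; h∣2βL = divides (1 + C * c) (begin
      2 * β * c            ≡⟨ cong (_* c) 2β≡k+Ch ⟩
      (k + C * h) * c      ≡⟨ lemma k C h c ⟩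
      c * k + C * c * h    ≡⟨ cong (_+ C * c * h) (sym h≡ck) ⟩
      h + C * c * h        ≡⟨ lemma′ h C c ⟩
      (1 + C * c) * h      ∎)
  ; h∣2βm = divides (2 * β) refl
  ; h∣βmm = divides (β * h) refl
  ; 2β≡Rk+Ch = trans 2β≡k+Ch (cong (_+ C * h) (sym (ℕ.*-identityˡ k)))
  }
  where
    open ≡-Reasoning
    lemma : ∀ k C h c → (k + C * h) * c ≡ c * k + C * c * h
    lemma = ℕ-Solver.solve-∀
    lemma′ : ∀ h C c → h + C * c * h ≡ (1 + C * c) * h
    lemma′ = ℕ-Solver.solve-∀

parameters-h≡2m : ∀ {h m k} L q → h ≡ 2 * m → L * k ≡ m → m ≡ 2 * q → Parameters h m k
parameters-h≡2m {h} {m} {k} L q h≡2m L*k≡m m≡2q = record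
  { R = 2 ; L = L ; β = k ; C = 0
  ; R*m≡h = sym h≡2m
  ; L*k≡m = L*k≡m
  ; h∣2βL = divides 1 (trans (lemma₁ k L) (trans (cong (2 *_) L*k≡m) (trans (sym h≡2m) (sym (ℕ.*-identityˡ h)))))
  ; h∣2βm = divides k (trans (lemma₂ k m) (cong (k *_) (sym h≡2m)))
  ; h∣βmm = divides (k * q) (trans (cong (k * m *_) m≡2q) (trans (lemma₃ k m q) (cong (k * q *_) (sym h≡2m))))
  ; 2β≡Rk+Ch = sym (ℕ.+-identityʳ (2 * k))
  }
  where
    lemma₁ : ∀ k L → 2 * k * L ≡ 2 * (L * k)
    lemma₁ = ℕ-Solver.solve-∀
    lemma₂ : ∀ k m → 2 * k * m ≡ k * (2 * m)
    lemma₂ = ℕ-Solver.solve-∀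
    lemma₃ : ∀ k m q → k * m * (2 * q) ≡ k * q * (2 * m)
    lemma₃ = ℕ-Solver.solve-∀

-- If c were even, either h/2 would be a smaller admissible value (4 ∣ c) or ν₂ n = 1 (c ≡ 2 mod 4).
odd-cofactor-of-h : ∀ {n h k c a b} → 0 < h → ¬ Val2 n 1 → Minimal n h →
                    k * h ≡ n → h ≡ c * k → k ≡ 1 + 2 * b → c ≢ 2 * a
odd-cofactor-of-h {n} {h} {k} {c} {a} {b} 0<h ν₂n≢1 minimal k*h≡n h≡ck k≡1+2b c≡2a with even-or-odd a
... | e , inj₁ a≡2e = ℕ.<⇒≱ h′<h (minimal h′ 0<h′ n∣h′² (λ (ν₂n≡1 , _) → ν₂n≢1 ν₂n≡1))
  where
    h′ = 2 * e * k
    h≡h′+h′ : h ≡ h′ + h′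
    h≡h′+h′ = trans h≡ck (trans (cong (_* k) (trans c≡2a (cong (2 *_) a≡2e))) (lemma e k))
      where lemma : ∀ e k → 2 * (2 * e) * k ≡ 2 * e * k + 2 * e * k
            lemma = ℕ-Solver.solve-∀
    0<h′ : 0 < h′
    0<h′ = ℕ.n≢0⇒n>0 (λ h′≡0 → ℕ.<⇒≢ 0<h (sym (trans h≡h′+h′ (cong (λ x → x + x) h′≡0))))
    h′<h : h′ < h
    h′<h = subst (h′ <_) (sym h≡h′+h′) (ℕ.m<m+n h′ 0<h′)
    n∣h′² : n ∣ h′ * h′
    n∣h′² = divides e (begin
      h′ * h′              ≡⟨ lemma e k ⟩
      e * (k * (h′ + h′))  ≡⟨ cong (λ x → e * (k * x)) (sym h≡h′+h′) ⟩
      e * (k * h)          ≡⟨ cong (e *_) k*h≡n ⟩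
      e * n                ∎)
      where
        open ≡-Reasoning
        lemma : ∀ e k → 2 * e * k * (2 * e * k) ≡ e * (k * (2 * e * k + 2 * e * k))
        lemma = ℕ-Solver.solve-∀
... | e , inj₂ a≡1+2e = ν₂n≢1 (twice-odd⇒Val2-1 w (begin
  n                                              ≡⟨ trans (sym k*h≡n) (cong (k *_) h≡ck) ⟩
  k * (c * k)                                    ≡⟨ cong₂ (λ c k → k * (c * k)) (trans c≡2a (cong (2 *_) a≡1+2e)) k≡1+2b ⟩
  (1 + 2 * b) * (2 * (1 + 2 * e) * (1 + 2 * b))  ≡⟨ lemma b e ⟩
  2 * (1 + 2 * w)                                ∎))
  where
    open ≡-Reasoning
    w = e + 2 * b + 4 * b * e + 2 * b * b + 4 * b * b * e
    lemma : ∀ b e → (1 + 2 * b) * (2 * (1 + 2 * e) * (1 + 2 * b)) ≡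
                    2 * (1 + 2 * (e + 2 * b + 4 * b * e + 2 * b * b + 4 * b * b * e))
    lemma = ℕ-Solver.solve-∀

parameters[ν₂n≢1] : ∀ {n h k m} → 0 < h → 0 < k → n ∣ h * h → ¬ Val2 n 1 → Minimal n h →
                    k * h ≡ n → m * k ≡ n → Parameters h m k
parameters[ν₂n≢1] {n} {h} {k} {m} 0<h 0<k (divides c h²≡cn) ν₂n≢1 minimal k*h≡n m*k≡n =
  subst (λ m → Parameters h m k) (sym m≡h)
        (parameters-m≡h c (proj₁ half) (proj₁ (proj₂ half)) h≡ck (proj₂ (proj₂ half)))
  where
    m≡h : m ≡ h
    m≡h = ℕ.*-cancelʳ-≡ m h k {{ℕ.>-nonZero 0<k}} (trans m*k≡n (trans (sym k*h≡n) (ℕ.*-comm k h)))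
    h≡ck : h ≡ c * k
    h≡ck = ℕ.*-cancelʳ-≡ h (c * k) h {{ℕ.>-nonZero 0<h}}
             (trans h²≡cn (trans (cong (c *_) (sym k*h≡n)) (sym (ℕ.*-assoc c k h))))
    half : Σ ℕ λ β → Σ ℕ λ C → 2 * β ≡ k + C * h
    half with even-or-odd k | even-or-odd c
    ... | b , inj₁ k≡2b | _ = b , 0 , trans (sym k≡2b) (sym (ℕ.+-identityʳ k))
    ... | b , inj₂ k≡1+2b | a , inj₁ c≡2a =
          ⊥-elim (odd-cofactor-of-h {a = a} {b} 0<h ν₂n≢1 minimal k*h≡n h≡ck k≡1+2b c≡2a)
    ... | b , inj₂ k≡1+2b | a , inj₂ c≡1+2a = 1 + a + 2 * b + 2 * a * b , 1 ,
          trans (lemma a b) (sym (cong₂ (λ k h → k + 1 * h) k≡1+2b (trans h≡ck (cong₂ _*_ c≡1+2a k≡1+2b))))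
      where lemma : ∀ a b → 2 * (1 + a + 2 * b + 2 * a * b) ≡ 1 + 2 * b + 1 * ((1 + 2 * a) * (1 + 2 * b))
            lemma = ℕ-Solver.solve-∀

odd-cofactor : ∀ {n m k q} → ¬ (4 ∣ n) → m * k ≡ n → m ≡ 2 * q → Σ ℕ λ b → k ≡ 1 + 2 * b
odd-cofactor {k = k} {q} ¬4∣n m*k≡n m≡2q with even-or-odd k
... | b , inj₂ k≡1+2b = b , k≡1+2b
... | b , inj₁ k≡2b = ⊥-elim (¬4∣n (divides (q * b) (trans (sym m*k≡n) (trans (cong₂ _*_ m≡2q k≡2b) (lemma q b)))))
  where lemma : ∀ q b → 2 * q * (2 * b) ≡ q * b * 4
        lemma = ℕ-Solver.solve-∀

parameters[ν₂n≡1] : ∀ {n h k m} → 0 < m → 0 < k → n ∣ h * h → Val2 n 1 → ¬ Val2 h 1 →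
                    k * h ≡ 2 * n → m * k ≡ n → Parameters h m k
parameters[ν₂n≡1] {n} {h} {k} {m} 0<m 0<k (divides c h²≡cn) (_ , ¬4∣n) ν₂h≢1 k*h≡2n m*k≡n =
  parameters-h≡2m (quotient k∣m) q h≡2m (sym (m∣n⇒n≡quotient*m k∣m)) m≡2q
  where
    open ≡-Reasoning
    h≡2m : h ≡ 2 * m
    h≡2m = ℕ.*-cancelʳ-≡ h (2 * m) k {{ℕ.>-nonZero 0<k}}
             (trans (ℕ.*-comm h k) (trans k*h≡2n (trans (cong (2 *_) (sym m*k≡n)) (sym (ℕ.*-assoc 2 m k)))))
    4∣h : 4 ∣ h
    4∣h = even∧¬Val2-1⇒4∣ (divides m (trans h≡2m (ℕ.*-comm 2 m))) ν₂h≢1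
    q = quotient 4∣h
    m≡2q : m ≡ 2 * q
    m≡2q = ℕ.*-cancelˡ-≡ m (2 * q) 2 (trans (sym h≡2m) (trans (m∣n⇒n≡quotient*m 4∣h) (lemma q)))
      where lemma : ∀ q → q * 4 ≡ 2 * (2 * q)
            lemma = ℕ-Solver.solve-∀
    k∣4m : k ∣ 2 * (2 * m)
    k∣4m = divides c (ℕ.*-cancelʳ-≡ (2 * (2 * m)) (c * k) m {{ℕ.>-nonZero 0<m}} (begin
      2 * (2 * m) * m    ≡⟨ lemma m ⟩
      2 * m * (2 * m)    ≡⟨ cong (λ x → x * x) (sym h≡2m) ⟩
      h * h              ≡⟨ h²≡cn ⟩
      c * n              ≡⟨ cong (c *_) (sym m*k≡n) ⟩
      c * (m * k)        ≡⟨ lemma′ c m k ⟩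
      c * k * m          ∎))
      where
        lemma : ∀ m → 2 * (2 * m) * m ≡ 2 * m * (2 * m)
        lemma = ℕ-Solver.solve-∀
        lemma′ : ∀ c m k → c * (m * k) ≡ c * k * m
        lemma′ = ℕ-Solver.solve-∀
    k-odd = odd-cofactor {q = q} ¬4∣n m*k≡n m≡2q
    k∣m : k ∣ m
    k∣m = odd∣2x⇒∣x (proj₁ k-odd) (proj₂ k-odd) (odd∣2x⇒∣x (proj₁ k-odd) (proj₂ k-odd) k∣4m)

Val2? : ∀ n → Dec (Val2 n 1)
Val2? n = (2 ∣? n) ×-dec ¬? (4 ∣? n)

parameters⇒orthogonalFamily : ∀ {h m k n} → 0 < h → 0 < m → 0 < k → m * k ≡ n → Parameters h m k →
                              OrthogonalFamily k m h n
parameters⇒orthogonalFamily {suc _} {suc _} {suc _} _ _ _ refl params = Construction.construction params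

lemma3p1 : (n h k m : ℕ) → 0 < n →
    -- h is the smallest positive integer with n ∣ h² and (ν₂ n, ν₂ h) ≠ (1,1)
    0 < h → n ∣ h * h → ¬ (Val2 n 1 × Val2 h 1) →
    (∀ h′ → 0 < h′ → n ∣ h′ * h′ → ¬ (Val2 n 1 × Val2 h′ 1) → h ≤ h′) →
    -- k = n/h if ν₂ n ≠ 1, k = 2n/h otherwise
    (¬ Val2 n 1 → k * h ≡ n) → (Val2 n 1 → k * h ≡ 2 * n) →
    -- m = n/k, the order of the group Z_{n/k}
    m * k ≡ n →
    Σ (Fin k → GR m h) λ D →
      (∀ i g → Σ (Fin h) λ e → D i g ≈C δ e) ×
      (∀ i j → i ≢ j → (D i *G (D j ⁻¹G)) ≈G 0G) ×
      (∑G (λ i → D i *G (D i ⁻¹G)) ≈G ιG (+ n))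
lemma3p1 n h k m 0<n 0<h n∣h² ν₂≢[1,1] minimal k*h≡n k*h≡2n m*k≡n =
  parameters⇒orthogonalFamily 0<h 0<m 0<k m*k≡n parameters
  where
    0<m : 0 < m
    0<m = ℕ.n≢0⇒n>0 (λ { refl → ℕ.<⇒≢ 0<n m*k≡n })
    0<k : 0 < k
    0<k = ℕ.n≢0⇒n>0 (λ { refl → ℕ.<⇒≢ 0<n (trans (sym (ℕ.*-zeroʳ m)) m*k≡n) })
    parameters : Parameters h m k
    parameters with Val2? n
    ... | yes ν₂n≡1 = parameters[ν₂n≡1] 0<m 0<k n∣h² ν₂n≡1 (λ ν₂h≡1 → ν₂≢[1,1] (ν₂n≡1 , ν₂h≡1)) (k*h≡2n ν₂n≡1) m*k≡n
    ... | no ν₂n≢1 = parameters[ν₂n≢1] 0<h 0<k n∣h² ν₂n≢1 minimal (k*h≡n ν₂n≢1) m*k≡n
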